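{- Let $G$ be a 3-colorable prismatic graph with at least two vertex-disjoint triangles, and let $(A,B,C)$ be a 3-coloring of $G$. For any two distinct color classes $X,Y\in\{A,B,C\}$, there exist three vertices $x_1,x_2,x_3$ inducing a path $P_3$ (with $x_1x_2,x_2x_3$ edges and $x_1x_3$ a non-edge) such that $x_1,x_3\in X$ and $x_2\in Y$.
   Context: A triangle is a set of three pairwise adjacent vertices; $G$ is prismatic if for every triangle $T$ every vertex not in $T$ has exactly one neighbor in $T$. A 3-coloring is a partition of $V(G)$ into three stable sets (color classes). -}

module Defs where

open import Data.Nat using (ℕ)
open import Data.Fin using (Fin)
open import Data.Product using (_×_; ∃-syntax)
open import Data.Sum using (_⊎_)
open import Relation.Nullary using (¬_)
open import Relation.Binary.PropositionalEquality using (_≡_; _≢_)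

record Graph (n : ℕ) : Set₁ where
  field
    Adj     : Fin n → Fin n → Set
    sym     : ∀ {u v} → Adj u v → Adj v u
    irrefl  : ∀ {v} → ¬ Adj v v

open Graph public

-- a triangle: three pairwise adjacent vertices (adjacency forces distinctness)
IsTriangle : ∀ {n} → Graph n → Fin n → Fin n → Fin n → Set
IsTriangle G a b c = Adj G a b × Adj G b c × Adj G a c

ExactlyOneNbr : ∀ {n} → Graph n → Fin n → Fin n → Fin n → Fin n → Set
ExactlyOneNbr G v a b c =
    (Adj G v a × ¬ Adj G v b × ¬ Adj G v c)
  ⊎ (¬ Adj G v a × Adj G v b × ¬ Adj G v c)
  ⊎ (¬ Adj G v a × ¬ Adj G v b × Adj G v c)

Prismatic : ∀ {n} → Graph n → Set
Prismatic {n} G = ∀ (a b c v : Fin n) → IsTriangle G a b c →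
  v ≢ a → v ≢ b → v ≢ c → ExactlyOneNbr G v a b c

HasTwoDisjointTriangles : ∀ {n} → Graph n → Set
HasTwoDisjointTriangles {n} G =
  ∃[ a ] ∃[ b ] ∃[ c ] ∃[ d ] ∃[ e ] ∃[ f ]
    (IsTriangle G a b c × IsTriangle G d e f ×
     (a ≢ d × a ≢ e × a ≢ f) × (b ≢ d × b ≢ e × b ≢ f) × (c ≢ d × c ≢ e × c ≢ f))

-- A 3-coloring (A,B,C) given as a map to Fin 3: class 0 = A, 1 = B, 2 = C.
-- Each class is stable: adjacent vertices receive different colours.
IsProper3Coloring : ∀ {n} → Graph n → (Fin n → Fin 3) → Set
IsProper3Coloring {n} G col = ∀ (u v : Fin n) → Adj G u v → col u ≢ col v

ThreeColorable : ∀ {n} → Graph n → Set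
ThreeColorable {n} G = ∃[ col ] IsProper3Coloring G col

InducedP3 : ∀ {n} → Graph n → Fin n → Fin n → Fin n → Set
InducedP3 G x₁ x₂ x₃ = Adj G x₁ x₂ × Adj G x₂ x₃ × ¬ Adj G x₁ x₃ × x₁ ≢ x₃

{-# OPTIONS --safe #-}
module Submission where

open import Defs hiding (sym)
open import Data.Nat using (ℕ)
open import Data.Fin using (Fin)
open import Data.Fin.Properties using (_≟_; all?)
open import Data.Product using (_×_; ∃-syntax; _,_)
open import Data.Sum using (_⊎_; inj₁; inj₂)
open import Data.Empty using (⊥-elim)
open import Relation.Nullary using (¬_; yes; no)
open import Relation.Nullary.Decidable using (¬?; _→-dec_; _⊎-dec_; from-yes)
open import Relation.Binary.PropositionalEquality using (_≡_; _≢_; refl; sym; trans; cong; subst₂)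

-- A proper 3-colouring uses all three colours on every triangle.
-- Take p, q in the first triangle coloured X, Y and s in the second coloured X.
-- In a prismatic graph q has a unique neighbour w in the second triangle, and
-- w is not coloured Y. If w is coloured X, then p–q–w is the path. Otherwise
-- p's unique neighbour w' there is not coloured X; if it is coloured Y, then
-- p–w'–s is the path. If not, w and w' both carry the third colour, so w = w'
-- is adjacent to both p and q, contradicting prismaticity for the first triangle.

_∈[_,_,_] : {A : Set} → A → A → A → A → Set
v ∈[ a , b , c ] = v ≡ a ⊎ v ≡ b ⊎ v ≡ c

distinct-cover-Fin3 : (x y z w : Fin 3) → x ≢ y → y ≢ z → x ≢ z → w ∈[ x , y , z ]
distinct-cover-Fin3 = from-yes
  (all? {3} λ x → all? {3} λ y → all? {3} λ z → all? {3} λ w →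
     ¬? (x ≟ y) →-dec ¬? (y ≟ z) →-dec ¬? (x ≟ z) →-dec
     (w ≟ x ⊎-dec w ≟ y ⊎-dec w ≟ z))

third-colour-unique : ∀ {X Y a b : Fin 3} → X ≢ Y →
  X ≢ a → Y ≢ a → X ≢ b → Y ≢ b → a ≡ b
third-colour-unique {X} {Y} {a} {b} X≢Y X≢a Y≢a X≢b Y≢b
  with distinct-cover-Fin3 X Y a b X≢Y Y≢a X≢a
... | inj₁ b≡X         = ⊥-elim (X≢b (sym b≡X))
... | inj₂ (inj₁ b≡Y)  = ⊥-elim (Y≢b (sym b≡Y))
... | inj₂ (inj₂ b≡a)  = sym b≡a

Disjoint : {A : Set} → (a b c d e f : A) → Set
Disjoint a b c d e f = ∀ {v} → v ∈[ a , b , c ] → ¬ v ∈[ d , e , f ]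

distinct-elements⇒disjoint : {A : Set} {a b c d e f : A} →
  (a ≢ d × a ≢ e × a ≢ f) → (b ≢ d × b ≢ e × b ≢ f) → (c ≢ d × c ≢ e × c ≢ f) →
  Disjoint a b c d e f
distinct-elements⇒disjoint (a≢d , _ , _) _ _ (inj₁ refl)        (inj₁ a≡d)        = a≢d a≡d
distinct-elements⇒disjoint (_ , a≢e , _) _ _ (inj₁ refl)        (inj₂ (inj₁ a≡e)) = a≢e a≡e
distinct-elements⇒disjoint (_ , _ , a≢f) _ _ (inj₁ refl)        (inj₂ (inj₂ a≡f)) = a≢f a≡f
distinct-elements⇒disjoint _ (b≢d , _ , _) _ (inj₂ (inj₁ refl)) (inj₁ b≡d)        = b≢d b≡d
distinct-elements⇒disjoint _ (_ , b≢e , _) _ (inj₂ (inj₁ refl)) (inj₂ (inj₁ b≡e)) = b≢e b≡e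
distinct-elements⇒disjoint _ (_ , _ , b≢f) _ (inj₂ (inj₁ refl)) (inj₂ (inj₂ b≡f)) = b≢f b≡f
distinct-elements⇒disjoint _ _ (c≢d , _ , _) (inj₂ (inj₂ refl)) (inj₁ c≡d)        = c≢d c≡d
distinct-elements⇒disjoint _ _ (_ , c≢e , _) (inj₂ (inj₂ refl)) (inj₂ (inj₁ c≡e)) = c≢e c≡e
distinct-elements⇒disjoint _ _ (_ , _ , c≢f) (inj₂ (inj₂ refl)) (inj₂ (inj₂ c≡f)) = c≢f c≡f

disjoint⇒distinct : {A : Set} {a b c d e f v w : A} → Disjoint a b c d e f →
  v ∈[ a , b , c ] → w ∈[ d , e , f ] → v ≢ w
disjoint⇒distinct disjoint v∈T w∈T′ refl = disjoint v∈T w∈T′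

module _ {n : ℕ} (G : Graph n) where

  triangle-adjacent : ∀ {a b c v w} → IsTriangle G a b c →
    v ∈[ a , b , c ] → w ∈[ a , b , c ] → v ≢ w → Adj G v w
  triangle-adjacent _             (inj₁ refl)        (inj₁ refl)        v≢w = ⊥-elim (v≢w refl)
  triangle-adjacent (ab , _ , _)  (inj₁ refl)        (inj₂ (inj₁ refl)) _   = ab
  triangle-adjacent (_ , _ , ac)  (inj₁ refl)        (inj₂ (inj₂ refl)) _   = ac
  triangle-adjacent (ab , _ , _)  (inj₂ (inj₁ refl)) (inj₁ refl)        _   = Graph.sym G ab
  triangle-adjacent _             (inj₂ (inj₁ refl)) (inj₂ (inj₁ refl)) v≢w = ⊥-elim (v≢w refl)
  triangle-adjacent (_ , bc , _)  (inj₂ (inj₁ refl)) (inj₂ (inj₂ refl)) _   = bc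
  triangle-adjacent (_ , _ , ac)  (inj₂ (inj₂ refl)) (inj₁ refl)        _   = Graph.sym G ac
  triangle-adjacent (_ , bc , _)  (inj₂ (inj₂ refl)) (inj₂ (inj₁ refl)) _   = Graph.sym G bc
  triangle-adjacent _             (inj₂ (inj₂ refl)) (inj₂ (inj₂ refl)) v≢w = ⊥-elim (v≢w refl)

  UniqueNeighbour : (v w a b c : Fin n) → Set
  UniqueNeighbour v w a b c =
    w ∈[ a , b , c ] × Adj G v w × (∀ {w′} → w′ ∈[ a , b , c ] → Adj G v w′ → w′ ≡ w)

  exactlyOneNbr⇒uniqueNeighbour : ∀ {v a b c} →
    ExactlyOneNbr G v a b c → ∃[ w ] UniqueNeighbour v w a b c
  exactlyOneNbr⇒uniqueNeighbour {v} {a} {b} {c} (inj₁ (va , ¬vb , ¬vc)) =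
    a , inj₁ refl , va , only-a
    where
    only-a : ∀ {w} → w ∈[ a , b , c ] → Adj G v w → w ≡ a
    only-a (inj₁ w≡a)         _  = w≡a
    only-a (inj₂ (inj₁ refl)) vb = ⊥-elim (¬vb vb)
    only-a (inj₂ (inj₂ refl)) vc = ⊥-elim (¬vc vc)
  exactlyOneNbr⇒uniqueNeighbour {v} {a} {b} {c} (inj₂ (inj₁ (¬va , vb , ¬vc))) =
    b , inj₂ (inj₁ refl) , vb , only-b
    where
    only-b : ∀ {w} → w ∈[ a , b , c ] → Adj G v w → w ≡ b
    only-b (inj₁ refl)        va = ⊥-elim (¬va va)
    only-b (inj₂ (inj₁ w≡b))  _  = w≡b
    only-b (inj₂ (inj₂ refl)) vc = ⊥-elim (¬vc vc)
  exactlyOneNbr⇒uniqueNeighbour {v} {a} {b} {c} (inj₂ (inj₂ (¬va , ¬vb , vc))) =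
    c , inj₂ (inj₂ refl) , vc , only-c
    where
    only-c : ∀ {w} → w ∈[ a , b , c ] → Adj G v w → w ≡ c
    only-c (inj₁ refl)        va = ⊥-elim (¬va va)
    only-c (inj₂ (inj₁ refl)) vb = ⊥-elim (¬vb vb)
    only-c (inj₂ (inj₂ w≡c))  _  = w≡c

  prismatic⇒uniqueNeighbour : Prismatic G → ∀ {a b c v} → IsTriangle G a b c →
    ¬ v ∈[ a , b , c ] → ∃[ w ] UniqueNeighbour v w a b c
  prismatic⇒uniqueNeighbour prismatic {a} {b} {c} {v} T v∉T =
    exactlyOneNbr⇒uniqueNeighbour
      (prismatic a b c v T (λ v≡a → v∉T (inj₁ v≡a))
        (λ v≡b → v∉T (inj₂ (inj₁ v≡b))) (λ v≡c → v∉T (inj₂ (inj₂ v≡c))))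

  prismatic⇒neighbours-equal : Prismatic G → ∀ {a b c v x y} → IsTriangle G a b c →
    ¬ v ∈[ a , b , c ] → x ∈[ a , b , c ] → y ∈[ a , b , c ] →
    Adj G v x → Adj G v y → x ≡ y
  prismatic⇒neighbours-equal prismatic T v∉T x∈T y∈T vx vy
    with prismatic⇒uniqueNeighbour prismatic T v∉T
  ... | _ , _ , _ , only = trans (only x∈T vx) (sym (only y∈T vy))

  module _ {col : Fin n → Fin 3} (proper : IsProper3Coloring G col) where

    sameColour⇒nonAdjacent : ∀ {v w} → col v ≡ col w → ¬ Adj G v w
    sameColour⇒nonAdjacent {v} {w} same vw = proper v w vw same

    sameColour⇒inducedP3 : ∀ {x₁ x₂ x₃} → Adj G x₁ x₂ → Adj G x₂ x₃ →
      col x₁ ≡ col x₃ → x₁ ≢ x₃ → InducedP3 G x₁ x₂ x₃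
    sameColour⇒inducedP3 x₁x₂ x₂x₃ same x₁≢x₃ =
      x₁x₂ , x₂x₃ , sameColour⇒nonAdjacent same , x₁≢x₃

    triangle-colour-injective : ∀ {a b c v w} → IsTriangle G a b c →
      v ∈[ a , b , c ] → w ∈[ a , b , c ] → col v ≡ col w → v ≡ w
    triangle-colour-injective {v = v} {w} T v∈T w∈T same with v ≟ w
    ... | yes v≡w = v≡w
    ... | no v≢w  = ⊥-elim (sameColour⇒nonAdjacent same (triangle-adjacent T v∈T w∈T v≢w))

    triangle-rainbow : ∀ {a b c} → IsTriangle G a b c →
      (X : Fin 3) → ∃[ v ] (v ∈[ a , b , c ] × col v ≡ X)
    triangle-rainbow {a} {b} {c} (ab , bc , ac) X
      with distinct-cover-Fin3 (col a) (col b) (col c) X (proper a b ab) (proper b c bc) (proper a c ac)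
    ... | inj₁ X≡a         = a , inj₁ refl , sym X≡a
    ... | inj₂ (inj₁ X≡b)  = b , inj₂ (inj₁ refl) , sym X≡b
    ... | inj₂ (inj₂ X≡c)  = c , inj₂ (inj₂ refl) , sym X≡c

    differentColours⇒adjacent : ∀ {a b c v w} → IsTriangle G a b c →
      v ∈[ a , b , c ] → w ∈[ a , b , c ] → col v ≢ col w → Adj G v w
    differentColours⇒adjacent T v∈T w∈T v≢w =
      triangle-adjacent T v∈T w∈T λ { refl → v≢w refl }

    P3Between : (X Y : Fin 3) → Set
    P3Between X Y = ∃[ x₁ ] ∃[ x₂ ] ∃[ x₃ ]
      (InducedP3 G x₁ x₂ x₃ × col x₁ ≡ X × col x₃ ≡ X × col x₂ ≡ Y)

    module _ (prismatic : Prismatic G) {a b c d e f : Fin n}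
             (T : IsTriangle G a b c) (T′ : IsTriangle G d e f)
             (disjoint : Disjoint a b c d e f) where

      sameColouredNeighbours⇒equal : ∀ {p q w w′} →
        p ∈[ a , b , c ] → q ∈[ a , b , c ] → w ∈[ d , e , f ] → w′ ∈[ d , e , f ] →
        Adj G p w → Adj G q w′ → col w ≡ col w′ → p ≡ q
      sameColouredNeighbours⇒equal p∈T q∈T w∈T′ w′∈T′ pw qw′ same
        with triangle-colour-injective T′ w∈T′ w′∈T′ same
      ... | refl = prismatic⇒neighbours-equal prismatic T (disjoint-sym w∈T′) p∈T q∈T
                     (Graph.sym G pw) (Graph.sym G qw′)
        where
        disjoint-sym : ∀ {v} → v ∈[ d , e , f ] → ¬ v ∈[ a , b , c ]
        disjoint-sym v∈T′ v∈T = disjoint v∈T v∈T′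

      P3Between-triangleColours : ∀ {p q s} →
        p ∈[ a , b , c ] → q ∈[ a , b , c ] → s ∈[ d , e , f ] →
        col p ≢ col q → col s ≡ col p → P3Between (col p) (col q)
      P3Between-triangleColours {p} {q} {s} p∈T q∈T s∈T′ p≢q s:p
        with prismatic⇒uniqueNeighbour prismatic T′ (disjoint q∈T)
           | prismatic⇒uniqueNeighbour prismatic T′ (disjoint p∈T)
      ... | w , w∈T′ , qw , _ | w′ , w′∈T′ , pw′ , _
        with col p ≟ col w | col q ≟ col w′
      ... | yes p:w | _ =
        p , q , w ,
        sameColour⇒inducedP3 (differentColours⇒adjacent T p∈T q∈T p≢q) qw p:w
          (disjoint⇒distinct disjoint p∈T w∈T′) ,
        refl , sym p:w , refl
      ... | no _ | yes q:w′ =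
        p , w′ , s ,
        sameColour⇒inducedP3 pw′
          (Graph.sym G (differentColours⇒adjacent T′ s∈T′ w′∈T′ (subst₂ _≢_ (sym s:p) q:w′ p≢q)))
          (sym s:p) (disjoint⇒distinct disjoint p∈T s∈T′) ,
        refl , s:p , sym q:w′
      ... | no p≢w | no q≢w′ =
        ⊥-elim (p≢q (cong col (sameColouredNeighbours⇒equal p∈T q∈T w′∈T′ w∈T′ pw′ qw
          (third-colour-unique p≢q (proper p w′ pw′) q≢w′ p≢w (proper q w qw)))))

      disjointTriangles⇒P3Between : ∀ {X Y} → X ≢ Y → P3Between X Y
      disjointTriangles⇒P3Between {X} {Y} X≢Y
        with triangle-rainbow T X | triangle-rainbow T Y | triangle-rainbow T′ X
      ... | p , p∈T , refl | q , q∈T , refl | s , s∈T′ , s:X =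
        P3Between-triangleColours p∈T q∈T s∈T′ X≢Y s:X

lemma4p7 : ∀ {n} (G : Graph n) → ThreeColorable G → Prismatic G →
    HasTwoDisjointTriangles G →
    (col : Fin n → Fin 3) → IsProper3Coloring G col →
    (X Y : Fin 3) → X ≢ Y →
    ∃[ x₁ ] ∃[ x₂ ] ∃[ x₃ ]
      (InducedP3 G x₁ x₂ x₃ × col x₁ ≡ X × col x₃ ≡ X × col x₂ ≡ Y)
-- ThreeColorable G is redundant: the colouring col witnesses it.
lemma4p7 G _ prismatic (_ , _ , _ , _ , _ , _ , T , T′ , a∉T′ , b∉T′ , c∉T′) col proper X Y X≢Y =
  disjointTriangles⇒P3Between G proper prismatic T T′
    (distinct-elements⇒disjoint a∉T′ b∉T′ c∉T′) X≢Y
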